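{- Let $n > 3$ and let \[ w_n = 1\, n\, 2\, 1\, 3\, 2\, 4\, 3\, 5\, 4 \cdots (n-1)\,(n-2)\, n\,(n-1), \] the word of length $2n$ on $\{1,\dots,n\}$ consisting of the letters $1, n$ followed, for $k=2,3,\dots,n$ in turn, by the two letters $k, k-1$. Then the $4n$ words obtained as one of the $2n$ cyclic shifts of $w_n$, optionally followed by a reversal, are pairwise distinct.
   Context: A cyclic shift (rotation) of $x_1 \cdots x_m$ is $x_{i+1}\cdots x_m x_1 \cdots x_i$ for some $0 \le i \le m-1$ (there are $m$ of them, including the identity shift $i=0$); the reversal (reflection) of $x_1\cdots x_m$ is $x_m \cdots x_1$. -}

module Defs where

open import Data.Nat using (ℕ; suc; _+_; _∸_)
open import Data.List using (List; []; _∷_; _++_; drop; take; reverse; concatMap; map)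
open import Data.List using (upTo)
open import Data.Bool using (Bool; true; false)

-- The word w_n = 1 n 2 1 3 2 ... n (n-1), as a list of naturals:
-- letters 1, n, followed for k = 2, ..., n in turn by k, k-1.
-- (upTo (n ∸ 1) = 0, 1, ..., n-2, so j+2 ranges over 2, ..., n.)
w : ℕ → List ℕ
w n = 1 ∷ n ∷ concatMap (λ j → (j + 2) ∷ (j + 1) ∷ []) (upTo (n ∸ 1))

rotate : ℕ → List ℕ → List ℕ
rotate i xs = drop i xs ++ take i xs

transform : ℕ → Bool → List ℕ → List ℕ
transform i false xs = rotate i xs
transform i true  xs = reverse (rotate i xs)

-- A reflection of a rotation of w_n is a rotation of reverse w_n, and if two rotations agree, the
-- letters of one word reappear in the other at a fixed cyclic offset. As w_n starts with 1 n and,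
-- for n > 3, "1 n" occurs only once as a cyclic factor of w_n, two equal rotations of w_n have
-- offset zero. As reverse w_n ends with n 1 and "n 1" is no cyclic factor of w_n, no rotation of
-- w_n equals a rotation of reverse w_n.
module Submission where

open import Defs
open import Data.Nat using (ℕ; _<_; _*_)
open import Data.Bool using (Bool)
open import Data.Product using (_×_; _,_)
open import Relation.Binary.PropositionalEquality using (_≡_)

open import Level using (Level)
open import Function using (_∘_)
open import Data.Bool using (true; false)
open import Data.Empty using (⊥; ⊥-elim)
open import Data.List using (List; []; _∷_; _++_; drop; take; reverse; length; map; concatMap; upTo; applyUpTo)
open import Data.List.Properties
  using (++-assoc; take++drop≡id; length-++-comm; length-drop; length-reverse; length-map;
         reverse-++; reverse-injective; unfold-reverse; map-concatMap; concatMap-map; map-applyUpTo)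
open import Data.Maybe using (Maybe; just; nothing)
open import Data.Nat using (zero; suc; _+_; _∸_; _≤_; z≤n; s≤s; z<s; NonZero; _%_; _<?_; >-nonZero)
open import Data.Nat.Properties
open import Data.Nat.DivMod
  using (m<n⇒m%n≡m; m%n<n; m%n%n≡m%n; [m+n]%n≡m%n; %-distribˡ-+; m≤n⇒[n∸m]%m≡n%m)
open import Data.Product using (∃-syntax)
open import Data.Sum using (_⊎_; inj₁; inj₂)
open import Relation.Nullary using (yes; no)
open import Relation.Nullary.Decidable using (True; toWitness)
open import Relation.Binary.PropositionalEquality using (refl; sym; trans; cong; cong₂; subst; _≢_; module ≡-Reasoning)

open ≡-Reasoning

private variable
  a b : Level
  A : Set a
  B : Set b

[m+n%d]%d≡[m+n]%d : ∀ m n d .{{_ : NonZero d}} → (m + n % d) % d ≡ (m + n) % d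
[m+n%d]%d≡[m+n]%d m n d = begin
  (m + n % d) % d            ≡⟨ %-distribˡ-+ m (n % d) d ⟩
  (m % d + n % d % d) % d    ≡⟨ cong (λ r → (m % d + r) % d) (m%n%n≡m%n n d) ⟩
  (m % d + n % d) % d        ≡⟨ %-distribˡ-+ m n d ⟨
  (m + n) % d                ∎

%-suc : ∀ m n .{{_ : NonZero n}} → suc (m % n) < n → suc m % n ≡ suc (m % n)
%-suc m n lt = trans (sym ([m+n%d]%d≡[m+n]%d 1 m n)) (m<n⇒m%n≡m lt)

[j+[n∸i]]%n≡0⇒j≡i : ∀ {i j n} .{{_ : NonZero n}} → i < n → j < n → (j + (n ∸ i)) % n ≡ 0 → j ≡ i
[j+[n∸i]]%n≡0⇒j≡i {i} {j} {n} i<n j<n ≡0 with j + (n ∸ i) <? n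
... | yes lt = ⊥-elim (m<n⇒n≢0 (m<n⇒0<n∸m i<n) (m+n≡0⇒n≡0 j (trans (sym (m<n⇒m%n≡m lt)) ≡0)))
... | no ≮ = +-cancelʳ-≡ _ j i (trans (≤-antisym ≤n (≮⇒≥ ≮)) (sym (m+[n∸m]≡n (<⇒≤ i<n))))
  where
  excess<n : j + (n ∸ i) ∸ n < n
  excess<n = m<n+o⇒m∸n<o _ n (+-mono-<-≤ j<n (m∸n≤m n i))
  excess≡0 : j + (n ∸ i) ∸ n ≡ 0
  excess≡0 = trans (sym (m<n⇒m%n≡m excess<n)) (trans (m≤n⇒[n∸m]%m≡n%m (≮⇒≥ ≮)) ≡0)
  ≤n : j + (n ∸ i) ≤ n
  ≤n = m∸n≡0⇒m≤n excess≡0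

_‼_ : List A → ℕ → Maybe A
[]       ‼ _     = nothing
(x ∷ xs) ‼ zero  = just x
(x ∷ xs) ‼ suc p = xs ‼ p

‼-++ˡ : ∀ (xs : List A) {ys p} → p < length xs → (xs ++ ys) ‼ p ≡ xs ‼ p
‼-++ˡ (x ∷ xs) {p = zero}  _          = refl
‼-++ˡ (x ∷ xs) {p = suc p} (s≤s p<n) = ‼-++ˡ xs p<n

‼-++ʳ : ∀ (xs : List A) {ys} p → (xs ++ ys) ‼ (length xs + p) ≡ ys ‼ p
‼-++ʳ []       p = refl
‼-++ʳ (x ∷ xs) p = ‼-++ʳ xs p

‼-drop : ∀ i (xs : List A) p → drop i xs ‼ p ≡ xs ‼ (i + p)
‼-drop zero    xs       p = refl
‼-drop (suc i) []       p = refl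
‼-drop (suc i) (x ∷ xs) p = ‼-drop i xs p

‼-map⁻ : ∀ (f : A → B) xs p {y} → map f xs ‼ p ≡ just y → ∃[ x ] xs ‼ p ≡ just x × f x ≡ y
‼-map⁻ f (x ∷ xs) zero    refl = x , refl , refl
‼-map⁻ f (x ∷ xs) (suc p) eq   = ‼-map⁻ f xs p eq

‼-reverse : ∀ (xs : List A) {p q} → suc (p + q) ≡ length xs → reverse xs ‼ p ≡ xs ‼ q
‼-reverse (x ∷ xs) {p} {q} eq = trans (cong (_‼ p) (unfold-reverse x xs)) (‼-∷ʳ q eq)
  where
  ‼-∷ʳ : ∀ q → suc (p + q) ≡ suc (length xs) → (reverse xs ++ x ∷ []) ‼ p ≡ (x ∷ xs) ‼ q
  ‼-∷ʳ zero eq = begin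
    (reverse xs ++ x ∷ []) ‼ p                         ≡⟨ cong ((reverse xs ++ x ∷ []) ‼_) p≡∣xs∣+0 ⟩
    (reverse xs ++ x ∷ []) ‼ (length (reverse xs) + 0) ≡⟨ ‼-++ʳ (reverse xs) 0 ⟩
    just x                                             ∎
    where
    p≡∣xs∣+0 : p ≡ length (reverse xs) + 0
    p≡∣xs∣+0 = trans (sym (+-identityʳ p)) (trans (suc-injective eq) (sym (trans (+-identityʳ _) (length-reverse xs))))
  ‼-∷ʳ (suc q) eq = trans (‼-++ˡ (reverse xs) p<) (‼-reverse xs eq′)
    where
    eq′ : suc (p + q) ≡ length xs
    eq′ = trans (sym (+-suc p q)) (suc-injective eq)
    p< : p < length (reverse xs)
    p< = subst (p <_) (trans eq′ (sym (length-reverse xs))) (s≤s (m≤m+n p q))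

length-rotate : ∀ i (xs : List ℕ) → length (rotate i xs) ≡ length xs
length-rotate i xs = trans (length-++-comm (drop i xs) (take i xs)) (cong length (take++drop≡id i xs))

drop-++ : ∀ i (xs : List A) {ys} → i ≤ length xs → drop i (xs ++ ys) ≡ drop i xs ++ ys
drop-++ zero    xs       _         = refl
drop-++ (suc i) (x ∷ xs) (s≤s i≤n) = drop-++ i xs i≤n

rotate-++ : ∀ (xs ys : List ℕ) → rotate (length xs) (xs ++ ys) ≡ ys ++ xs
rotate-++ xs ys = cong₂ _++_ (drop-length xs) (take-length xs)
  where
  drop-length : ∀ (xs : List ℕ) → drop (length xs) (xs ++ ys) ≡ ys
  drop-length []       = refl
  drop-length (x ∷ xs) = drop-length xs
  take-length : ∀ (xs : List ℕ) → take (length xs) (xs ++ ys) ≡ xs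
  take-length []       = refl
  take-length (x ∷ xs) = cong (x ∷_) (take-length xs)

reverse-rotate : ∀ i (xs : List ℕ) → reverse (rotate i xs) ≡ rotate (length xs ∸ i) (reverse xs)
reverse-rotate i xs = begin
  reverse (drop i xs ++ take i xs)                          ≡⟨ reverse-++ (drop i xs) (take i xs) ⟩
  reverse (take i xs) ++ reverse (drop i xs)                ≡⟨ rotate-++ (reverse (drop i xs)) (reverse (take i xs)) ⟨
  rotate (length (reverse (drop i xs)))
         (reverse (drop i xs) ++ reverse (take i xs))       ≡⟨ cong₂ rotate ∣reverse-drop∣ (sym (reverse-++ (take i xs) (drop i xs))) ⟩
  rotate (length xs ∸ i) (reverse (take i xs ++ drop i xs)) ≡⟨ cong (rotate (length xs ∸ i) ∘ reverse) (take++drop≡id i xs) ⟩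
  rotate (length xs ∸ i) (reverse xs)                       ∎
  where
  ∣reverse-drop∣ : length (reverse (drop i xs)) ≡ length xs ∸ i
  ∣reverse-drop∣ = trans (length-reverse (drop i xs)) (length-drop i xs)

‼-rotate : ∀ i (xs : List ℕ) {p} → i ≤ length xs → p < length xs → rotate i xs ‼ p ≡ (xs ++ xs) ‼ (i + p)
‼-rotate i xs {p} i≤n p<n = begin
  rotate i xs ‼ p                 ≡⟨ ‼-++ˡ (rotate i xs) (subst (p <_) (sym (length-rotate i xs)) p<n) ⟨
  (rotate i xs ++ drop i xs) ‼ p  ≡⟨ cong (_‼ p) rotate-++-drop ⟩
  drop i (xs ++ xs) ‼ p           ≡⟨ ‼-drop i (xs ++ xs) p ⟩
  (xs ++ xs) ‼ (i + p)            ∎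
  where
  rotate-++-drop : rotate i xs ++ drop i xs ≡ drop i (xs ++ xs)
  rotate-++-drop = begin
    (drop i xs ++ take i xs) ++ drop i xs ≡⟨ ++-assoc (drop i xs) (take i xs) (drop i xs) ⟩
    drop i xs ++ (take i xs ++ drop i xs) ≡⟨ cong (drop i xs ++_) (take++drop≡id i xs) ⟩
    drop i xs ++ xs                       ≡⟨ drop-++ i xs i≤n ⟨
    drop i (xs ++ xs)                     ∎

‼-++-self : ∀ {N} .{{_ : NonZero N}} (xs : List A) → length xs ≡ N →
            ∀ {q} → q < N + N → (xs ++ xs) ‼ q ≡ xs ‼ (q % N)
‼-++-self {N = N} xs refl {q} q<2N with q <? N
... | yes q<N = trans (‼-++ˡ xs q<N) (cong (xs ‼_) (sym (m<n⇒m%n≡m q<N)))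
... | no q≮N = begin
  (xs ++ xs) ‼ q            ≡⟨ cong ((xs ++ xs) ‼_) (m+[n∸m]≡n (≮⇒≥ q≮N)) ⟨
  (xs ++ xs) ‼ (N + (q ∸ N)) ≡⟨ ‼-++ʳ xs (q ∸ N) ⟩
  xs ‼ (q ∸ N)              ≡⟨ cong (xs ‼_) q∸N≡q%N ⟩
  xs ‼ (q % N)              ∎
  where
  q∸N≡q%N : q ∸ N ≡ q % N
  q∸N≡q%N = trans (sym (m<n⇒m%n≡m (m<n+o⇒m∸n<o q N q<2N))) (m≤n⇒[n∸m]%m≡n%m (≮⇒≥ q≮N))

‼-rotate-% : ∀ {N} .{{_ : NonZero N}} {i p} (xs : List ℕ) → length xs ≡ N → i ≤ N → p < N →
             rotate i xs ‼ p ≡ xs ‼ ((i + p) % N)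
‼-rotate-% xs refl i≤N p<N = trans (‼-rotate _ xs i≤N p<N) (‼-++-self xs refl (+-mono-≤-< i≤N p<N))

rotate≡rotate⇒‼-% : ∀ {N} .{{_ : NonZero N}} {i j} (xs ys : List ℕ) → length xs ≡ N → length ys ≡ N →
                    i ≤ N → j ≤ N → rotate i xs ≡ rotate j ys →
                    ∀ q → xs ‼ ((i + q) % N) ≡ ys ‼ ((j + q) % N)
rotate≡rotate⇒‼-% {N = N} {i} {j} xs ys ∣xs∣ ∣ys∣ i≤N j≤N eq q = begin
  xs ‼ ((i + q) % N)      ≡⟨ cong (xs ‼_) ([m+n%d]%d≡[m+n]%d i q N) ⟨
  xs ‼ ((i + q % N) % N)  ≡⟨ ‼-rotate-% xs ∣xs∣ i≤N (m%n<n q N) ⟨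
  rotate i xs ‼ (q % N)   ≡⟨ cong (_‼ (q % N)) eq ⟩
  rotate j ys ‼ (q % N)   ≡⟨ ‼-rotate-% ys ∣ys∣ j≤N (m%n<n q N) ⟩
  ys ‼ ((j + q % N) % N)  ≡⟨ cong (ys ‼_) ([m+n%d]%d≡[m+n]%d j q N) ⟩
  ys ‼ ((j + q) % N)      ∎

rotate≡rotate⇒‼ : ∀ {N} .{{_ : NonZero N}} {i j} (xs ys : List ℕ) → length xs ≡ N → length ys ≡ N →
                  i ≤ N → j ≤ N → rotate i xs ≡ rotate j ys →
                  ∀ {r} → r < N → ys ‼ ((r + (j + (N ∸ i))) % N) ≡ xs ‼ r
rotate≡rotate⇒‼ {N = N} {i} {j} xs ys ∣xs∣ ∣ys∣ i≤N j≤N eq {r} r<N = begin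
  ys ‼ ((r + (j + (N ∸ i))) % N)  ≡⟨ cong (λ k → ys ‼ (k % N)) (trans (+-comm r _) (+-assoc j (N ∸ i) r)) ⟩
  ys ‼ ((j + (N ∸ i + r)) % N)    ≡⟨ rotate≡rotate⇒‼-% xs ys ∣xs∣ ∣ys∣ i≤N j≤N eq (N ∸ i + r) ⟨
  xs ‼ ((i + (N ∸ i + r)) % N)    ≡⟨ cong (λ k → xs ‼ (k % N)) i+[N∸i+r]≡r+N ⟩
  xs ‼ ((r + N) % N)              ≡⟨ cong (xs ‼_) (trans ([m+n]%n≡m%n r N) (m<n⇒m%n≡m r<N)) ⟩
  xs ‼ r                          ∎
  where
  i+[N∸i+r]≡r+N : i + (N ∸ i + r) ≡ r + N
  i+[N∸i+r]≡r+N = trans (sym (+-assoc i (N ∸ i) r)) (trans (cong (_+ r) (m+[n∸m]≡n i≤N)) (+-comm N r))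

descentPairs : ℕ → List ℕ
descentPairs zero    = []
descentPairs (suc m) = 2 ∷ 1 ∷ map suc (descentPairs m)

w≡ : ∀ m → w (suc m) ≡ 1 ∷ suc m ∷ descentPairs m
w≡ m = cong (λ ds → 1 ∷ suc m ∷ ds) (pairs≡descentPairs m)
  where
  pair : ℕ → List ℕ
  pair j = (j + 2) ∷ (j + 1) ∷ []
  pairs≡descentPairs : ∀ m → concatMap pair (upTo m) ≡ descentPairs m
  pairs≡descentPairs zero    = refl
  pairs≡descentPairs (suc m) = cong (λ ds → 2 ∷ 1 ∷ ds) (begin
    concatMap pair (applyUpTo suc m)   ≡⟨ cong (concatMap pair) (map-applyUpTo (λ j → j) suc m) ⟨
    concatMap pair (map suc (upTo m))  ≡⟨ concatMap-map pair suc (upTo m) ⟩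
    concatMap (map suc ∘ pair) (upTo m) ≡⟨ map-concatMap suc pair (upTo m) ⟨
    map suc (concatMap pair (upTo m))  ≡⟨ cong (map suc) (pairs≡descentPairs m) ⟩
    map suc (descentPairs m)           ∎)

length-descentPairs : ∀ m → length (descentPairs m) ≡ m + m
length-descentPairs zero    = refl
length-descentPairs (suc m) = begin
  suc (suc (length (map suc (descentPairs m)))) ≡⟨ cong (suc ∘ suc) (length-map suc (descentPairs m)) ⟩
  suc (suc (length (descentPairs m)))           ≡⟨ cong (suc ∘ suc) (length-descentPairs m) ⟩
  suc (suc (m + m))                             ≡⟨ cong suc (+-suc m m) ⟨
  suc m + suc m                                 ∎

descentPairs-‼≢0 : ∀ m r → descentPairs m ‼ r ≢ just 0
descentPairs-‼≢0 zero    r             ()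
descentPairs-‼≢0 (suc m) zero          ()
descentPairs-‼≢0 (suc m) (suc zero)    ()
descentPairs-‼≢0 (suc m) (suc (suc r)) eq with ‼-map⁻ suc (descentPairs m) r eq
... | _ , _ , ()

descentPairs-‼≡1 : ∀ m r → descentPairs m ‼ r ≡ just 1 → r ≡ 1
descentPairs-‼≡1 zero    r             ()
descentPairs-‼≡1 (suc m) zero          ()
descentPairs-‼≡1 (suc m) (suc zero)    _  = refl
descentPairs-‼≡1 (suc m) (suc (suc r)) eq with ‼-map⁻ suc (descentPairs m) r eq
... | _ , letter≡0 , refl = ⊥-elim (descentPairs-‼≢0 m r letter≡0)

descentPairs-‼≡1+m : ∀ m r → descentPairs m ‼ r ≡ just (suc m) → suc (suc r) ≡ m + m
descentPairs-‼≡1+m zero    r             ()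
descentPairs-‼≡1+m (suc m) zero          refl = refl
descentPairs-‼≡1+m (suc m) (suc zero)    ()
descentPairs-‼≡1+m (suc m) (suc (suc r)) eq with ‼-map⁻ suc (descentPairs m) r eq
... | _ , letter≡1+m , refl =
  trans (cong (suc ∘ suc) (descentPairs-‼≡1+m m r letter≡1+m)) (cong suc (sym (+-suc m m)))

2*n≡n+n : ∀ n → 2 * n ≡ n + n
2*n≡n+n n = cong (n +_) (+-identityʳ n)

length-w : ∀ {n} → 0 < n → length (w n) ≡ 2 * n
length-w {suc m} _ = begin
  length (w (suc m))                  ≡⟨ cong length (w≡ m) ⟩
  suc (suc (length (descentPairs m))) ≡⟨ cong (suc ∘ suc) (length-descentPairs m) ⟩
  suc (suc (m + m))                   ≡⟨ cong suc (+-suc m m) ⟨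
  suc m + suc m                       ≡⟨ 2*n≡n+n (suc m) ⟨
  2 * suc m                           ∎

w-‼≡1 : ∀ {n p} → 1 < n → w n ‼ p ≡ just 1 → p ≡ 0 ⊎ p ≡ 3
w-‼≡1 {suc (suc m)} {p} (s≤s (s≤s z≤n)) eq = positions p (subst (λ ws → ws ‼ p ≡ just 1) (w≡ (suc m)) eq)
  where
  positions : ∀ p → (1 ∷ suc (suc m) ∷ descentPairs (suc m)) ‼ p ≡ just 1 → p ≡ 0 ⊎ p ≡ 3
  positions zero          _  = inj₁ refl
  positions (suc zero)    ()
  positions (suc (suc r)) eq = inj₂ (cong (suc ∘ suc) (descentPairs-‼≡1 (suc m) r eq))

w-‼≡n : ∀ {n p} → 1 < n → w n ‼ p ≡ just n → p ≡ 1 ⊎ suc (suc p) ≡ 2 * n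
w-‼≡n {n@(suc (suc m))} {p} (s≤s (s≤s z≤n)) eq = positions p (subst (λ ws → ws ‼ p ≡ just n) (w≡ (suc m)) eq)
  where
  positions : ∀ p → (1 ∷ n ∷ descentPairs (suc m)) ‼ p ≡ just n → p ≡ 1 ⊎ suc (suc p) ≡ 2 * n
  positions zero          ()
  positions (suc zero)    _  = inj₁ refl
  positions (suc (suc r)) eq = inj₂ (begin
    suc (suc (suc (suc r)))         ≡⟨ cong (suc ∘ suc) (descentPairs-‼≡1+m (suc m) r eq) ⟩
    suc (suc (suc (m + suc m)))     ≡⟨ cong (suc ∘ suc) (+-suc m (suc m)) ⟨
    n + n                           ≡⟨ 2*n≡n+n n ⟨
    2 * n                           ∎)

module _ {n : ℕ} (3<n : 3 < n) where
  private
    N : ℕ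
    N = 2 * n

    8≤N : 8 ≤ N
    8≤N = *-monoʳ-≤ 2 3<n

    small<N : ∀ k {k≤7 : True (k ≤? 7)} → k < N
    small<N k {k≤7} = ≤-trans (s≤s (toWitness k≤7)) 8≤N

    instance
      N-nonZero : NonZero N
      N-nonZero = >-nonZero (small<N 0)

    1<n : 1 < n
    1<n = <-trans (s≤s (s≤s z≤n)) 3<n

    ∣w∣ : length (w n) ≡ N
    ∣w∣ = length-w (<-trans z<s 1<n)

    next-position : ∀ q {r} → q % N ≡ r → suc r < N → suc q % N ≡ suc r
    next-position q q%N≡r r+1<N =
      trans (%-suc q N (subst (λ r → suc r < N) (sym q%N≡r) r+1<N)) (cong suc q%N≡r)

  w-1-then-n⇒%≡0 : ∀ q → w n ‼ (q % N) ≡ just 1 → w n ‼ (suc q % N) ≡ just n → q % N ≡ 0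
  w-1-then-n⇒%≡0 q one then-n with w-‼≡1 1<n one
  ... | inj₁ q%N≡0 = q%N≡0
  ... | inj₂ q%N≡3 with w-‼≡n {p = 4} 1<n (trans (cong (w n ‼_) (sym (next-position q q%N≡3 (small<N 4)))) then-n)
  ...   | inj₁ ()
  ...   | inj₂ 6≡N = ⊥-elim (<⇒≢ (small<N 6) 6≡N)

  w-¬n-then-1 : ∀ q → w n ‼ (q % N) ≡ just n → w n ‼ (suc q % N) ≡ just 1 → ⊥
  w-¬n-then-1 q here then-1 with w-‼≡n 1<n here
  ... | inj₁ q%N≡1 with w-‼≡1 {p = 2} 1<n (trans (cong (w n ‼_) (sym (next-position q q%N≡1 (small<N 2)))) then-1)
  ...   | inj₁ ()
  ...   | inj₂ ()
  w-¬n-then-1 q here then-1 | inj₂ q%N+2≡N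
    with w-‼≡1 1<n (trans (cong (w n ‼_) (sym (next-position q refl (subst (suc (suc (q % N)) ≤_) q%N+2≡N ≤-refl)))) then-1)
  ...   | inj₁ ()
  ...   | inj₂ q%N+1≡3 = <⇒≢ (small<N 4) (trans (cong suc (sym q%N+1≡3)) q%N+2≡N)

  rotate-w-injective : ∀ {i j} → i < N → j < N → rotate i (w n) ≡ rotate j (w n) → i ≡ j
  rotate-w-injective {i} {j} i<N j<N eq =
    sym ([j+[n∸i]]%n≡0⇒j≡i i<N j<N (w-1-then-n⇒%≡0 (j + (N ∸ i)) (letter (small<N 0)) (letter (small<N 1))))
    where
    letter : ∀ {r} → r < N → w n ‼ ((r + (j + (N ∸ i))) % N) ≡ w n ‼ r
    letter = rotate≡rotate⇒‼ (w n) (w n) ∣w∣ ∣w∣ (<⇒≤ i<N) (<⇒≤ j<N) eq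

  rotate-w≢reverse-rotate-w : ∀ {i j} → i < N → j < N → rotate i (w n) ≢ reverse (rotate j (w n))
  rotate-w≢reverse-rotate-w {i} {j} i<N j<N eq = w-¬n-then-1 (M + c) at-M at-M+1
    where
    c = i + (N ∸ (N ∸ j))
    M = N ∸ 2
    M+2≡N : suc (suc M) ≡ N
    M+2≡N = m+[n∸m]≡n (small<N 1)
    M+1<N : suc M < N
    M+1<N = subst (suc M <_) M+2≡N (n<1+n (suc M))
    ∣reverse-w∣ : length (reverse (w n)) ≡ N
    ∣reverse-w∣ = trans (length-reverse (w n)) ∣w∣
    eq′ : rotate (N ∸ j) (reverse (w n)) ≡ rotate i (w n)
    eq′ = sym (trans eq (trans (reverse-rotate j (w n)) (cong (λ l → rotate (l ∸ j) (reverse (w n))) ∣w∣)))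
    letter : ∀ {r} → r < N → w n ‼ ((r + c) % N) ≡ reverse (w n) ‼ r
    letter = rotate≡rotate⇒‼ (reverse (w n)) (w n) ∣reverse-w∣ ∣w∣ (m∸n≤m N j) (<⇒≤ i<N) eq′
    mirror : ∀ {p q} → suc (p + q) ≡ N → reverse (w n) ‼ p ≡ w n ‼ q
    mirror p+q+1≡N = ‼-reverse (w n) (trans p+q+1≡N (sym ∣w∣))
    at-M : w n ‼ ((M + c) % N) ≡ just n
    at-M = trans (letter (<-trans (n<1+n M) M+1<N)) (mirror (trans (cong suc (+-comm M 1)) M+2≡N))
    at-M+1 : w n ‼ (suc (M + c) % N) ≡ just 1
    at-M+1 = trans (letter M+1<N) (mirror (trans (cong (suc ∘ suc) (+-identityʳ M)) M+2≡N))

lemma2 : (n : ℕ) → 3 < n →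
    (i j : ℕ) → i < 2 * n → j < 2 * n → (b c : Bool) →
    transform i b (w n) ≡ transform j c (w n) → (i ≡ j) × (b ≡ c)
lemma2 n 3<n i j i<N j<N false false eq = rotate-w-injective 3<n i<N j<N eq , refl
lemma2 n 3<n i j i<N j<N false true  eq = ⊥-elim (rotate-w≢reverse-rotate-w 3<n i<N j<N eq)
lemma2 n 3<n i j i<N j<N true  false eq = ⊥-elim (rotate-w≢reverse-rotate-w 3<n j<N i<N (sym eq))
lemma2 n 3<n i j i<N j<N true  true  eq = rotate-w-injective 3<n i<N j<N (reverse-injective eq) , refl
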